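{- Let $p$ be a process of an LTS and $\varphi\in\mathrm{SHML}$ closed. The following are equivalent: (i) $p\in[\![\varphi]\!]_B$; (ii) for every finfinite trace $g$ produced by $p$, $g\in[\![\varphi]\!]_F$.
   Context: Fix a finite set $\mathit{Act}$ of actions and $\tau\notin\mathit{Act}$. $\mathrm{SHML}$: $\varphi::=\mathrm{tt}\mid\mathrm{ff}\mid[A]\varphi\mid\varphi\wedge\varphi\mid\max X.\varphi\mid X$ with $A\subseteq\mathit{Act}$, guarded. LTS: $\langle\mathit{Proc},\mathit{Act}\cup\{\tau\},\to\rangle$; $p\Rightarrow q$ means $p(\xrightarrow{\tau})^*q$, $p\xRightarrow{a}q$ means $p\Rightarrow\xrightarrow{a}\Rightarrow q$. A process $p$ produces a finite trace $s=a_1\cdots a_k$ if $p\xRightarrow{a_1}\cdots\xRightarrow{a_k}q$ for some $q$, and produces an infinite trace $a_1a_2\cdots$ if there are $p=p_0,p_1,\ldots$ with $p_{i-1}\xRightarrow{a_i}p_i$ for all $i\ge1$. Branching semantics: $[\![\mathrm{tt}]\!]_B=\mathit{Proc}$, $[\![\mathrm{ff}]\!]_B=\emptyset$, $\wedge$ intersection, $[\![[A]\varphi]\!]_B=\{p\mid\forall q,\forall a\in A.\ p\xRightarrow{a}q\Rightarrow q\in[\![\varphi]\!]_B\}$, $[\![\max X.\varphi,\rho]\!]_B=\bigcup\{P\mid P\subseteq[\![\varphi,\rho[X\mapsto P]]\!]_B\}$, $[\![X,\rho]\!]_B=\rho(X)$. Finfinite semantics over $\mathit{FTrc}=\mathit{Act}^*\cup\mathit{Act}^\omega$: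 $[\![\mathrm{tt}]\!]_F=\mathit{FTrc}$, $[\![\mathrm{ff}]\!]_F=\emptyset$, $\wedge$ intersection, $[\![[A]\varphi]\!]_F=\{g\mid\forall a\in A,\forall g'.\ g=ag'\Rightarrow g'\in[\![\varphi]\!]_F\}$, $[\![\max X.\varphi,\sigma]\!]_F=\bigcup\{S\mid S\subseteq[\![\varphi,\sigma[X\mapsto S]]\!]_F\}$, $[\![X,\sigma]\!]_F=\sigma(X)$. -}

module Defs where

open import Level using (Lift; lift) renaming (suc to lsuc; zero to lzero)
open import Data.Nat using (ℕ; zero; suc)
open import Data.Fin using (Fin; zero; suc)
open import Data.Fin.Subset using (Subset; _∈_)
open import Data.List using (List; []; _∷_)
open import Data.Unit using (⊤)
open import Data.Empty using (⊥)
open import Data.Product using (Σ; _×_; ∃; _,_)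
open import Relation.Nullary using (¬_)
open import Relation.Binary.PropositionalEquality using (_≡_)
open import Relation.Binary.Construct.Closure.ReflexiveTransitive using (Star)

data Label (n : ℕ) : Set where
  τ   : Label n
  act : Fin n → Label n

record LTS (n : ℕ) : Set₁ where
  field
    Proc : Set
    _—[_]→_ : Proc → Label n → Proc → Set

  _⇒_ : Proc → Proc → Set
  _⇒_ = Star (λ p q → p —[ τ ]→ q)

  _⇒[_]_ : Proc → Fin n → Proc → Set
  p ⇒[ a ] q = Σ Proc λ p' → Σ Proc λ q' → (p ⇒ p') × (p' —[ act a ]→ q') × (q' ⇒ q)

  data _⇒*[_]_ : Proc → List (Fin n) → Proc → Set where
    []  : ∀ {p} → p ⇒*[ [] ] p
    _∷_ : ∀ {p p' q a s} → p ⇒[ a ] p' → p' ⇒*[ s ] q → p ⇒*[ a ∷ s ] q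

open LTS public

data FTrc (n : ℕ) : Set where
  fin : List (Fin n) → FTrc n
  inf : (ℕ → Fin n) → FTrc n

data IsCons {n : ℕ} : FTrc n → Fin n → FTrc n → Set where
  finC : ∀ a l → IsCons (fin (a ∷ l)) a (fin l)
  infC : ∀ f → IsCons (inf f) (f zero) (inf (λ i → f (suc i)))

Produces : ∀ {n} (L : LTS n) → Proc L → FTrc n → Set
Produces L p (fin s) = Σ (Proc L) λ q → _⇒*[_]_ L p s q
Produces L p (inf f) =
  Σ (ℕ → Proc L) λ ps → (ps zero ≡ p) × (∀ i → _⇒[_]_ L (ps i) (f i) (ps (suc i)))

-- SHML syntax, with de Bruijn variables: Form n k has k variables in scope.
-- box A φ is [A]φ with A ⊆ Act; max φ binds variable zero.

data Form (n : ℕ) (k : ℕ) : Set where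
  tt ff : Form n k
  box   : Subset n → Form n k → Form n k
  _∧_   : Form n k → Form n k → Form n k
  max   : Form n (suc k) → Form n k
  var   : Fin k → Form n k

data Unguarded {n : ℕ} : ∀ {k} → Form n k → Fin k → Set where
  var  : ∀ {k} (x : Fin k) → Unguarded (var x) x
  ∧ˡ   : ∀ {k} {φ ψ : Form n k} {x} → Unguarded φ x → Unguarded (φ ∧ ψ) x
  ∧ʳ   : ∀ {k} {φ ψ : Form n k} {x} → Unguarded ψ x → Unguarded (φ ∧ ψ) x
  max  : ∀ {k} {φ : Form n (suc k)} {x} → Unguarded φ (suc x) → Unguarded (max φ) x

data Guarded {n : ℕ} : ∀ {k} → Form n k → Set where
  tt  : ∀ {k} → Guarded {k = k} tt
  ff  : ∀ {k} → Guarded {k = k} ff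
  box : ∀ {k} A {φ : Form n k} → Guarded φ → Guarded (box A φ)
  _∧_ : ∀ {k} {φ ψ : Form n k} → Guarded φ → Guarded ψ → Guarded (φ ∧ ψ)
  max : ∀ {k} {φ : Form n (suc k)} → ¬ Unguarded φ zero → Guarded φ → Guarded (max φ)
  var : ∀ {k} (x : Fin k) → Guarded (var x)

Env : ∀ (A : Set) (k : ℕ) → Set₁
Env A k = Fin k → A → Set

extend : ∀ {A k} → Env A k → (A → Set) → Env A (suc k)
extend ρ P zero    = P
extend ρ P (suc x) = ρ x

emptyEnv : ∀ {A} → Env A 0
emptyEnv ()

-- Branching semantics  ⟦φ, ρ⟧_B ⊆ Proc ; gfp = union of post-fixed points

⟦_⟧B : ∀ {n k} (L : LTS n) → Form n k → Env (Proc L) k → Proc L → Set₁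
⟦ L ⟧B tt ρ p = Lift _ ⊤
⟦ L ⟧B ff ρ p = Lift _ ⊥
⟦ L ⟧B (box A φ) ρ p = ∀ (q : Proc L) (a : Fin _) → a ∈ A → _⇒[_]_ L p a q → ⟦ L ⟧B φ ρ q
⟦ L ⟧B (φ ∧ ψ) ρ p = ⟦ L ⟧B φ ρ p × ⟦ L ⟧B ψ ρ p
⟦ L ⟧B (max φ) ρ p =
  Σ (Proc L → Set) λ P → (∀ q → P q → ⟦ L ⟧B φ (extend ρ P) q) × P p
⟦ L ⟧B (var x) ρ p = Lift _ (ρ x p)

⟦_⟧F : ∀ {n k} → Form n k → Env (FTrc n) k → FTrc n → Set₁
⟦ tt ⟧F σ g = Lift _ ⊤
⟦ ff ⟧F σ g = Lift _ ⊥
⟦ box A φ ⟧F σ g = ∀ a → a ∈ A → ∀ g' → IsCons g a g' → ⟦ φ ⟧F σ g'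
⟦ φ ∧ ψ ⟧F σ g = ⟦ φ ⟧F σ g × ⟦ ψ ⟧F σ g
⟦ max φ ⟧F σ g =
  Σ (FTrc _ → Set) λ S → (∀ h → S h → ⟦ φ ⟧F (extend σ S) h) × S g
⟦ var x ⟧F σ g = Lift _ (σ x g)

-- Sets of processes and sets of finfinite traces are related by the Galois
-- connection  Traces P ⊆ S  ⇔  P ⊆ Processes S,  where Traces P collects the
-- traces produced by members of P and Processes S is the set of processes all of
-- whose traces lie in S.  By induction on φ, in environments related through this
-- connection, Traces ⟦φ⟧B ⊆ ⟦φ⟧F and Processes ⟦φ⟧F ⊆ ⟦φ⟧B.  The box case holds
-- because the traces of p starting with a are exactly a followed by the traces of
-- the weak a-successors of p.  For max, a post-fixed set P of processes yields the
-- post-fixed set Traces P; conversely, if every trace g of p lies in some post-fixed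
-- set S_g, then by monotonicity their union S is post-fixed and Processes S is a
-- post-fixed set of processes containing p.
module Submission where

open import Defs
open import Data.Nat using (ℕ; zero; suc)
open import Function.Bundles using (_⇔_; mk⇔)
open import Function.Base using (id)
open import Level using (lift; lower)
open import Data.Fin using (Fin; zero; suc)
open import Data.List using ([]; _∷_)
open import Data.Product using (Σ; _×_; _,_; proj₁; proj₂)
open import Relation.Binary.PropositionalEquality using (refl; subst; sym)
open import Relation.Unary using (Pred; _⊆_; ⋃)

Pointwise : ∀ {A B : Set} {k} → (Pred A _ → Pred B _ → Set) → Env A k → Env B k → Set
Pointwise R ρ σ = ∀ x → R (ρ x) (σ x)

extend-pointwise : ∀ {A B : Set} {k} (R : Pred A _ → Pred B _ → Set)
                     {ρ : Env A k} {σ : Env B k} {P S} →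
                   Pointwise R ρ σ → R P S → Pointwise R (extend ρ P) (extend σ S)
extend-pointwise R Rρσ RPS zero    = RPS
extend-pointwise R Rρσ RPS (suc x) = Rρσ x

⟦⟧F-mono : ∀ {n k} (φ : Form n k) {σ σ′ : Env (FTrc n) k} →
           Pointwise _⊆_ σ σ′ → ⟦ φ ⟧F σ ⊆ ⟦ φ ⟧F σ′
⟦⟧F-mono tt        σ⊆σ′ h               = h
⟦⟧F-mono ff        σ⊆σ′ h               = h
⟦⟧F-mono (box A φ) σ⊆σ′ h a a∈A g′ cons = ⟦⟧F-mono φ σ⊆σ′ (h a a∈A g′ cons)
⟦⟧F-mono (φ ∧ ψ)   σ⊆σ′ (hφ , hψ)       = ⟦⟧F-mono φ σ⊆σ′ hφ , ⟦⟧F-mono ψ σ⊆σ′ hψ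
⟦⟧F-mono (max φ)   σ⊆σ′ (S , post , Sg) =
  S , (λ h Sh → ⟦⟧F-mono φ (extend-pointwise _⊆_ σ⊆σ′ id) (post h Sh)) , Sg
⟦⟧F-mono (var x)   σ⊆σ′ (lift h)        = lift (σ⊆σ′ x h)

PostFixedF : ∀ {n k} → Form n (suc k) → Env (FTrc n) k → Pred (FTrc n) _ → Set₁
PostFixedF φ σ S = S ⊆ ⟦ φ ⟧F (extend σ S)

⋃-postFixedF : ∀ {n k} (φ : Form n (suc k)) {σ : Env (FTrc n) k}
                 {I : Set} (S : I → Pred (FTrc n) _) →
               (∀ i → PostFixedF φ σ (S i)) → PostFixedF φ σ (⋃ I S)
⋃-postFixedF φ S post (i , Sig) =
  ⟦⟧F-mono φ (extend-pointwise _⊆_ (λ _ → id) (i ,_)) (post i Sig)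

_∷ᶠ_ : ∀ {n} → Fin n → FTrc n → FTrc n
a ∷ᶠ fin l = fin (a ∷ l)
a ∷ᶠ inf f = inf λ { zero → a ; (suc i) → f i }

isCons-∷ᶠ : ∀ {n} (a : Fin n) g → IsCons (a ∷ᶠ g) a g
isCons-∷ᶠ a (fin l) = finC a l
isCons-∷ᶠ a (inf f) = infC _

module _ {n : ℕ} (L : LTS n) where

  produces-ε : ∀ {p} → Produces L p (fin [])
  produces-ε = _ , []

  produces-∷ᶠ : ∀ {p q a} g → _⇒[_]_ L p a q → Produces L q g → Produces L p (a ∷ᶠ g)
  produces-∷ᶠ (fin l) step (r , steps)            = r , (step ∷ steps)
  produces-∷ᶠ {p} {q} {a} (inf f) step (ps , ps₀≡q , steps) =
    (λ { zero → p ; (suc i) → ps i }) , refl ,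
    λ { zero → subst (_⇒[_]_ L p a) (sym ps₀≡q) step ; (suc i) → steps i }

  produces-uncons : ∀ {p g a g′} → Produces L p g → IsCons g a g′ →
                    Σ (Proc L) λ q → _⇒[_]_ L p a q × Produces L q g′
  produces-uncons (r , (step ∷ steps)) (finC a l) = _ , step , (r , steps)
  produces-uncons (ps , refl , steps) (infC f) =
    ps (suc zero) , steps zero , ((λ i → ps (suc i)) , refl , λ i → steps (suc i))

  Traces : ∀ {ℓ} → Pred (Proc L) ℓ → Pred (FTrc n) ℓ
  Traces P g = Σ (Proc L) λ q → P q × Produces L q g

  Processes : ∀ {ℓ} → Pred (FTrc n) ℓ → Pred (Proc L) ℓ
  Processes S q = ∀ g → Produces L q g → S g

  _⊑_ : Pred (Proc L) _ → Pred (FTrc n) _ → Set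
  P ⊑ S = Traces P ⊆ S

  _⊒_ : Pred (Proc L) _ → Pred (FTrc n) _ → Set
  P ⊒ S = Processes S ⊆ P

  traces-⟦⟧B⊆⟦⟧F : ∀ {k} (φ : Form n k) {ρ : Env (Proc L) k} {σ : Env (FTrc n) k} →
                   Pointwise _⊑_ ρ σ →
                   Traces (⟦ L ⟧B φ ρ) ⊆ ⟦ φ ⟧F σ
  traces-⟦⟧B⊆⟦⟧F tt        Rρσ _ = lift _
  traces-⟦⟧B⊆⟦⟧F ff        Rρσ (_ , lift () , _)
  traces-⟦⟧B⊆⟦⟧F (box A φ) Rρσ (p , h , pr) a a∈A g′ cons
    with produces-uncons pr cons
  ... | q , step , pr′ = traces-⟦⟧B⊆⟦⟧F φ Rρσ (q , h q a a∈A step , pr′)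
  traces-⟦⟧B⊆⟦⟧F (φ ∧ ψ)   Rρσ (p , (hφ , hψ) , pr) =
    traces-⟦⟧B⊆⟦⟧F φ Rρσ (p , hφ , pr) , traces-⟦⟧B⊆⟦⟧F ψ Rρσ (p , hψ , pr)
  traces-⟦⟧B⊆⟦⟧F (max φ)   Rρσ (p , (P , post , Pp) , pr) =
    Traces P , (λ _ → postFixed) , (p , Pp , pr)
    where
    postFixed : PostFixedF φ _ (Traces P)
    postFixed (q , Pq , prq) =
      traces-⟦⟧B⊆⟦⟧F φ (extend-pointwise _⊑_ Rρσ id) (q , post q Pq , prq)
  traces-⟦⟧B⊆⟦⟧F (var x)   Rρσ (p , lift h , pr) = lift (Rρσ x (p , h , pr))

  processes-⟦⟧F⊆⟦⟧B : ∀ {k} (φ : Form n k) {ρ : Env (Proc L) k} {σ : Env (FTrc n) k} →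
                      Pointwise _⊒_ ρ σ →
                      Processes (⟦ φ ⟧F σ) ⊆ ⟦ L ⟧B φ ρ
  processes-⟦⟧F⊆⟦⟧B tt        Rρσ H = lift _
  processes-⟦⟧F⊆⟦⟧B ff        Rρσ H = H (fin []) produces-ε
  processes-⟦⟧F⊆⟦⟧B (box A φ) Rρσ H q a a∈A step =
    processes-⟦⟧F⊆⟦⟧B φ Rρσ λ g pr →
      H (a ∷ᶠ g) (produces-∷ᶠ g step pr) a a∈A g (isCons-∷ᶠ a g)
  processes-⟦⟧F⊆⟦⟧B (φ ∧ ψ)   Rρσ H =
    processes-⟦⟧F⊆⟦⟧B φ Rρσ (λ g pr → proj₁ (H g pr)) ,
    processes-⟦⟧F⊆⟦⟧B ψ Rρσ (λ g pr → proj₂ (H g pr))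
  processes-⟦⟧F⊆⟦⟧B (max φ) {ρ} Rρσ {p} H =
    Processes S , postFixed , (λ g pr → (g , pr) , proj₂ (proj₂ (H g pr)))
    where
    witness : Σ (FTrc n) (Produces L p) → Pred (FTrc n) _
    witness (g , pr) = proj₁ (H g pr)

    S : Pred (FTrc n) _
    S = ⋃ _ witness

    postFixedS : PostFixedF φ _ S
    postFixedS = ⋃-postFixedF φ witness λ (g , pr) → proj₁ (proj₂ (H g pr)) _

    postFixed : ∀ q → Processes S q → ⟦ L ⟧B φ (extend ρ (Processes S)) q
    postFixed q Sq =
      processes-⟦⟧F⊆⟦⟧B φ (extend-pointwise _⊒_ Rρσ id) λ g pr → postFixedS (Sq g pr)
  processes-⟦⟧F⊆⟦⟧B (var x)   Rρσ H = lift (Rρσ x λ g pr → lower (H g pr))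

mainTheorem15 : ∀ {n : ℕ} (L : LTS n) (p : Proc L) (φ : Form n 0) → Guarded φ →
    (⟦ L ⟧B φ emptyEnv p ⇔ (∀ (g : FTrc n) → Produces L p g → ⟦ φ ⟧F emptyEnv g))
mainTheorem15 L p φ _ =
  mk⇔ (λ p⊨φ g pr → traces-⟦⟧B⊆⟦⟧F L φ (λ ()) (p , p⊨φ , pr))
      (processes-⟦⟧F⊆⟦⟧B L φ (λ ()))
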